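{- Let $A$ and $B$ be finite nonempty subsets of an abelian group. If $|2A|\ge\frac32|A|$, then $|A+B|\ge 2\min\{|B|,\frac34|A|\}$.
   Context: $2A=A+A$, $A+B=\{a+b\colon a\in A,b\in B\}$. (In the paper, sets with $|2A|<\frac32|A|$ are called very-small-doubling sets; the hypothesis is that $A$ is not such a set.) -}

module Defs where

open import Level using (_⊔_)
open import Algebra.Bundles using (AbelianGroup)
open import Data.List using (List)
open import Data.Product using (_×_; ∃-syntax)
open import Function.Bundles using (_⇔_)
import Data.List.Membership.Setoid as SetoidMembership
import Data.List.Relation.Unary.Unique.Setoid as SetoidUnique

module _ {c ℓ} (G : AbelianGroup c ℓ) where
  open AbelianGroup G
  open SetoidMembership setoid using (_∈_)

  -- A finite subset of G is represented by a duplicate-free list (up to ≈).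
  IsFinSubset : List Carrier → Set (c ⊔ ℓ)
  IsFinSubset A = SetoidUnique.Unique setoid A

  IsSumset : List Carrier → List Carrier → List Carrier → Set (c ⊔ ℓ)
  IsSumset A B S =
    IsFinSubset S ×
    (∀ x → (x ∈ S) ⇔ (∃[ a ] ∃[ b ] (a ∈ A × b ∈ B × x ≈ a ∙ b)))

module Submission where

-- Write t = |A + B|, α = |A|, β = |B| and suppose 2t < 4β and 2t < 3α; we show |2A| ≤ t,
-- contradicting 3α ≤ 2|2A|.  Since t < 2β, any two translates a + B, a' + B meet inside A + B.
-- Averaging the αβ representations a + b over the t sums gives a sum y with more than t − α
-- representations, and then y + b − b' ∈ A + B for all b, b' ∈ B.  For b, b' ∈ B more than
-- 2α − t elements z ∈ A satisfy z + b ∈ A + b', so since 2t < 3α two such sets always meet in A.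
-- Combining these facts, y + a₁ + a₂ − 2a₀ ∈ A + B for all a₀, a₁, a₂ ∈ A, i.e. a translate of
-- 2A lies in A + B.  Equality in the group is not decidable, so every set-splitting step is
-- carried out under a double negation, which the decidable conclusion finally discharges.

open import Defs
open import Algebra.Bundles using (AbelianGroup)
open import Data.Empty using (⊥-elim)
open import Data.List using (List; []; _∷_; length; map; _++_; cartesianProduct)
open import Data.List.Properties using (length-map; length-++; length-removeAt′)
open import Data.List.Relation.Binary.Sublist.Propositional using ([]; _∷_; _∷ʳ_)
  renaming (_⊆_ to _⊑_)
open import Data.List.Relation.Binary.Sublist.Propositional.Properties using (All-resp-⊆)
open import Data.List.Relation.Unary.All as All using (All; []; _∷_)
import Data.List.Relation.Unary.All.Properties as Allₚ
open import Data.List.Relation.Unary.AllPairs using (AllPairs; []; _∷_)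
open import Data.List.Relation.Unary.Any using (here; there; index; _─_)
import Data.List.Membership.Setoid as Membership
import Data.List.Membership.Setoid.Properties as Membershipₚ
import Data.List.Relation.Unary.Unique.Setoid as Unique
import Data.List.Relation.Unary.Unique.Setoid.Properties as Uniqueₚ
open import Data.Nat using (ℕ; suc; _+_; _*_; _∸_; _≤_; _<_; _⊓_; z≤n; s≤s)
open import Data.Nat.Properties
open import Data.Nat.Tactic.RingSolver using (solve-∀)
open import Data.Product using (_×_; _,_; proj₁; proj₂; ∃-syntax)
open import Data.Product.Relation.Binary.Pointwise.NonDependent using (_×ₛ_)
open import Function using (_∘_; id)
open import Function.Bundles using (Equivalence)
open import Level using (_⊔_)
open import Relation.Binary.Bundles using (Setoid)
open import Relation.Binary.PropositionalEquality as ≡ using (_≡_; _≢_)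
open import Relation.Nullary using (¬_; Dec; yes; no)
open import Relation.Nullary.Decidable using (decidable-stable; ¬¬-excluded-middle)
open import Relation.Nullary.Negation using (DoubleNegation; ¬¬-Monad)

module _ {a} {X : Set a} where

  AllPairs-resp-⊑ : ∀ {r} {R : X → X → Set r} {xs ys} → xs ⊑ ys → AllPairs R ys → AllPairs R xs
  AllPairs-resp-⊑ []           []       = []
  AllPairs-resp-⊑ (_ ∷ʳ τ)     (_ ∷ rs) = AllPairs-resp-⊑ τ rs
  AllPairs-resp-⊑ (≡.refl ∷ τ) (r ∷ rs) = All-resp-⊆ τ r ∷ AllPairs-resp-⊑ τ rs

  record Partition {p} (P : X → Set p) (xs : List X) : Set (a ⊔ p) where
    field
      accepted rejected : List X
      accepted⊑ : accepted ⊑ xs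
      rejected⊑ : rejected ⊑ xs
      all-accepted : All P accepted
      all-rejected : All (¬_ ∘ P) rejected
      length-partition : length accepted + length rejected ≡ length xs

  ¬¬-partition : ∀ {p} (P : X → Set p) xs → DoubleNegation (Partition P xs)
  ¬¬-partition P [] k = k (record
    { accepted = [] ; rejected = [] ; accepted⊑ = [] ; rejected⊑ = []
    ; all-accepted = [] ; all-rejected = [] ; length-partition = ≡.refl })
  ¬¬-partition P (x ∷ xs) k =
    ¬¬-excluded-middle λ x? → ¬¬-partition P xs λ part → k (extend x? part)
    where
    extend : Dec (P x) → Partition P xs → Partition P (x ∷ xs)
    extend (yes px) part = record
      { accepted = x ∷ accepted ; rejected = rejected
      ; accepted⊑ = ≡.refl ∷ accepted⊑ ; rejected⊑ = x ∷ʳ rejected⊑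
      ; all-accepted = px ∷ all-accepted ; all-rejected = all-rejected
      ; length-partition = ≡.cong suc length-partition }
      where open Partition part
    extend (no ¬px) part = record
      { accepted = accepted ; rejected = x ∷ rejected
      ; accepted⊑ = x ∷ʳ accepted⊑ ; rejected⊑ = ≡.refl ∷ rejected⊑
      ; all-accepted = all-accepted ; all-rejected = ¬px ∷ all-rejected
      ; length-partition = ≡.trans (+-suc (length accepted) (length rejected)) (≡.cong suc length-partition) }
      where open Partition part

  length-cartesianProduct : ∀ {b} {Y : Set b} (xs : List X) (ys : List Y) →
                            length (cartesianProduct xs ys) ≡ length xs * length ys
  length-cartesianProduct []       ys = ≡.refl
  length-cartesianProduct (x ∷ xs) ys = begin
    length (map (x ,_) ys ++ cartesianProduct xs ys)     ≡⟨ length-++ (map (x ,_) ys) ⟩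
    length (map (x ,_) ys) + length (cartesianProduct xs ys)
      ≡⟨ ≡.cong₂ _+_ (length-map (x ,_) ys) (length-cartesianProduct xs ys) ⟩
    length ys + length xs * length ys                     ∎
    where open ≡.≡-Reasoning

module Counting {c ℓ} (S : Setoid c ℓ) where
  open Setoid S
  open Membership S using (_∈_)
  open Unique S using (Unique)

  ∈-─ : ∀ {x y ys} (x∈ys : x ∈ ys) → y ∈ ys → ¬ x ≈ y → y ∈ (ys ─ x∈ys)
  ∈-─ (here x≈z) (here y≈z) x≉y = ⊥-elim (x≉y (trans x≈z (sym y≈z)))
  ∈-─ (here _)   (there y∈) _   = y∈
  ∈-─ (there _)  (here y≈z) _   = here y≈z
  ∈-─ (there x∈) (there y∈) x≉y = there (∈-─ x∈ y∈ x≉y)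

  length-mono-⊆ : ∀ {xs ys} → Unique xs → All (_∈ ys) xs → length xs ≤ length ys
  length-mono-⊆ []            []                = z≤n
  length-mono-⊆ {ys = ys} (x∉xs ∷ xs!) (x∈ys ∷ xs⊆ys) =
    ≤-trans (s≤s (length-mono-⊆ xs! (All.zipWith (λ (y∈ys , x≉y) → ∈-─ x∈ys y∈ys x≉y) (xs⊆ys , x∉xs))))
            (≤-reflexive (≡.sym (length-removeAt′ ys (index x∈ys))))

  nonempty-member : ∀ {xs} → xs ≢ [] → ∃[ x ] x ∈ xs
  nonempty-member {[]}    xs≢[] = ⊥-elim (xs≢[] ≡.refl)
  nonempty-member {x ∷ _} _     = x , here refl

  pigeonhole : ∀ {xs ys zs} → Unique xs → Unique ys → All (_∈ zs) xs → All (_∈ zs) ys →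
               length zs < length xs + length ys → DoubleNegation (∃[ v ] v ∈ xs × v ∈ ys)
  pigeonhole {xs} xs! ys! xs⊆zs ys⊆zs zs<xs+ys disjoint =
    <⇒≱ zs<xs+ys (≤-trans (≤-reflexive (≡.sym (length-++ xs)))
      (length-mono-⊆ (Uniqueₚ.++⁺ S xs! ys! (λ (v∈xs , v∈ys) → disjoint (_ , v∈xs , v∈ys)))
                     (Allₚ.++⁺ xs⊆zs ys⊆zs)))

module FibreCounting {c₁ ℓ₁ c₂ ℓ₂ q} (S : Setoid c₁ ℓ₁) (T : Setoid c₂ ℓ₂)
  (Q : Setoid.Carrier S → Set q) (f : Setoid.Carrier S → Setoid.Carrier T) (m : ℕ) where
  open Setoid T using (_≈_; refl; sym)
  open Membership T using (_∈_)
  open Unique S using (Unique)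

  FibresBounded : Set (c₁ ⊔ ℓ₁ ⊔ c₂ ⊔ ℓ₂ ⊔ q)
  FibresBounded = ∀ {y F} → Unique F → All Q F → All (λ x → f x ≈ y) F → length F ≤ m

  ¬¬-count-by-fibres : FibresBounded → ∀ M {D} → Unique D → All Q D → All (λ x → f x ∈ M) D →
                       DoubleNegation (length D ≤ length M * m)
  ¬¬-count-by-fibres bounded [] {[]} _ _ _ k = k z≤n
  ¬¬-count-by-fibres bounded [] {_ ∷ _} _ _ (() ∷ _)
  ¬¬-count-by-fibres bounded (y ∷ M) {D} D! QD fD⊆yM k =
    ¬¬-partition (λ x → f x ≈ y) D λ part → let open Partition part in
    ¬¬-count-by-fibres bounded M (AllPairs-resp-⊑ rejected⊑ D!) (All-resp-⊆ rejected⊑ QD)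
      (All.zipWith (λ (fx∈yM , fx≉y) → Counting.∈-─ T (here refl) fx∈yM (fx≉y ∘ sym))
                   (All-resp-⊆ rejected⊑ fD⊆yM , all-rejected))
      λ rejected≤ → k (begin
        length D                            ≡⟨ ≡.sym length-partition ⟩
        length accepted + length rejected   ≤⟨ +-mono-≤ (bounded (AllPairs-resp-⊑ accepted⊑ D!)
                                                          (All-resp-⊆ accepted⊑ QD) all-accepted)
                                                        rejected≤ ⟩
        m + length M * m                    ∎)
    where open ≤-Reasoning

  count-by-fibres : FibresBounded → ∀ M {D} → Unique D → All Q D → All (λ x → f x ∈ M) D →
                    length D ≤ length M * m
  count-by-fibres bounded M D! QD fD⊆M =
    decidable-stable (_ ≤? _) (¬¬-count-by-fibres bounded M D! QD fD⊆M)

2*m<4*n⇒m<n+n : ∀ m n → 2 * m < 4 * n → m < n + n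
2*m<4*n⇒m<n+n m n 2m<4n = *-cancelˡ-< 2 m (n + n) (≡.subst (2 * m <_) (four n) 2m<4n)
  where
  four : ∀ n → 4 * n ≡ 2 * (n + n)
  four = solve-∀

twice-excess< : ∀ α t → 2 * t < 3 * α → 2 * (t ∸ α) < α
twice-excess< α t 2t<3α with α ≤? t
... | no α≰t rewrite m≤n⇒m∸n≡0 (<⇒≤ (≰⇒> α≰t)) = ≤-<-trans z≤n (≰⇒> α≰t)
... | yes α≤t = +-cancelˡ-< (2 * α) (2 * (t ∸ α)) α (begin-strict
  2 * α + 2 * (t ∸ α) ≡⟨ ≡.sym (*-distribˡ-+ 2 α (t ∸ α)) ⟩
  2 * (α + (t ∸ α))   ≡⟨ ≡.cong (2 *_) (m+[n∸m]≡n α≤t) ⟩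
  2 * t               <⟨ 2t<3α ⟩
  3 * α               ≡⟨ three α ⟩
  2 * α + α           ∎)
  where
  open ≤-Reasoning
  three : ∀ α → 3 * α ≡ 2 * α + α
  three = solve-∀

-- The averaging inequality: αβ representations cannot fit into t sums with at most t − α each.
αβ≰t*[t∸α] : ∀ α β t → 0 < β → t < β + β → 2 * t < 3 * α → ¬ (α * β ≤ t * (t ∸ α))
αβ≰t*[t∸α] α β@(suc _) t _ t<2β 2t<3α αβ≤ = <-irrefl ≡.refl (begin-strict
  α * β             ≤⟨ αβ≤ ⟩
  t * (t ∸ α)       ≤⟨ *-monoˡ-≤ (t ∸ α) (<⇒≤ t<2β) ⟩
  (β + β) * (t ∸ α) ≡⟨ regroup β (t ∸ α) ⟩
  β * (2 * (t ∸ α)) <⟨ *-monoʳ-< β (twice-excess< α t 2t<3α) ⟩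
  β * α             ≡⟨ *-comm β α ⟩
  α * β             ∎)
  where
  open ≤-Reasoning
  regroup : ∀ β k → (β + β) * k ≡ β * (2 * k)
  regroup = solve-∀

module _ {c ℓ} (G : AbelianGroup c ℓ) where
  open AbelianGroup G renaming (Carrier to X)
  open Membership setoid using (_∈_)
  open Membershipₚ using (∈-resp-≈)
  open Unique setoid using (Unique)
  open Counting setoid
  open import Algebra.Properties.Group group using (∙-cancelˡ; ∙-cancelʳ; x≈z//y)
  open import Algebra.Solver.CommutativeMonoid commutativeMonoid using (solve; _⊕_; _⊜_)

  translates-meet : ∀ {T L L' g g'} → Unique L → Unique L' →
                    (∀ {x} → x ∈ L → x ∙ g ∈ T) → (∀ {x} → x ∈ L' → x ∙ g' ∈ T) →
                    length T < length L + length L' →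
                    DoubleNegation (∃[ x ] ∃[ x' ] x ∈ L × x' ∈ L' × x ∙ g ≈ x' ∙ g')
  translates-meet {T} {L} {L'} {g} {g'} L! L'! L∙g⊆T L'∙g'⊆T T<L+L' k =
    pigeonhole (translate-unique g L!) (translate-unique g' L'!)
      (Allₚ.map⁺ (All.tabulateₛ setoid L∙g⊆T)) (Allₚ.map⁺ (All.tabulateₛ setoid L'∙g'⊆T))
      (≡.subst₂ (λ m n → length T < m + n)
        (≡.sym (length-map (_∙ g) L)) (≡.sym (length-map (_∙ g') L')) T<L+L')
      λ (v , v∈L∙g , v∈L'∙g') →
        let x  , x∈L   , v≈x∙g   = Membershipₚ.∈-map⁻ setoid setoid v∈L∙g
            x' , x'∈L' , v≈x'∙g' = Membershipₚ.∈-map⁻ setoid setoid v∈L'∙g'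
        in k (x , x' , x∈L , x'∈L' , trans (sym v≈x∙g) v≈x'∙g')
    where
    translate-unique : ∀ g {L} → Unique L → Unique (map (_∙ g) L)
    translate-unique g = Uniqueₚ.map⁺ setoid setoid (∙-cancelʳ g _ _)

  fibre-heads-unique : ∀ {y F} → Unique.Unique (setoid ×ₛ setoid) F → All (λ (a , b) → a ∙ b ≈ y) F →
                       Unique (map proj₁ F)
  fibre-heads-unique []            []             = []
  fibre-heads-unique (p∉F ∷ F!) (ab≈y ∷ F≈y) =
    Allₚ.map⁺ (All.zipWith (λ (p≉q , a'b'≈y) a≈a' → p≉q (a≈a' , same-tail ab≈y a'b'≈y a≈a'))
                           (p∉F , F≈y))
    ∷ fibre-heads-unique F! F≈y
    where
    same-tail : ∀ {y a b a' b'} → a ∙ b ≈ y → a' ∙ b' ≈ y → a ≈ a' → b ≈ b'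
    same-tail ab≈y a'b'≈y a≈a' = ∙-cancelˡ _ _ _ (trans ab≈y (trans (sym a'b'≈y) (∙-congʳ (sym a≈a'))))

  popular-identity : ∀ {y f c b a b'} → y ≈ f ∙ c → f ∙ b ≈ a ∙ b' → y ∙ b ≈ (a ∙ c) ∙ b'
  popular-identity {y} {f} {c} {b} {a} {b'} y≈fc fb≈ab' = begin
    y ∙ b         ≈⟨ ∙-congʳ y≈fc ⟩
    (f ∙ c) ∙ b   ≈⟨ solve 3 (λ f c b → (f ⊕ c) ⊕ b ⊜ (f ⊕ b) ⊕ c) refl f c b ⟩
    (f ∙ b) ∙ c   ≈⟨ ∙-congʳ fb≈ab' ⟩
    (a ∙ b') ∙ c  ≈⟨ solve 3 (λ a b' c → (a ⊕ b') ⊕ c ⊜ (a ⊕ c) ⊕ b') refl a b' c ⟩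
    (a ∙ c) ∙ b'  ∎
    where open import Relation.Binary.Reasoning.Setoid setoid

  -- In additive notation: u − y = d' − d = a' − a = (b₁' − b₁) + (b₂' − b₂) = (a₁ − a₀) + (a₂ − a₀);
  -- formally, add up the six equations and cancel the summand K common to both sides.
  double-identity : ∀ {y u a₀ a₁ a₂ a a' z b₁ b₁' b₂ b₂' d d'} →
                    b₁ ∙ a₁ ≈ b₁' ∙ a₀ → b₂ ∙ a₂ ≈ b₂' ∙ a₀ → z ∙ b₁ ≈ a ∙ b₁' → z ∙ b₂' ≈ a' ∙ b₂ →
                    d ∙ a' ≈ d' ∙ a → y ∙ d' ≈ u ∙ d → u ∙ (a₀ ∙ a₀) ≈ y ∙ (a₁ ∙ a₂)
  double-identity {y} {u} {a₀} {a₁} {a₂} {a} {a'} {z} {b₁} {b₁'} {b₂} {b₂'} {d} {d'} E₁ E₂ E₃ E₄ E₅ E₆ =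
    ∙-cancelʳ K _ _ (begin
      (u ∙ (a₀ ∙ a₀)) ∙ K
        ≈⟨ solve 14 (λ y u a₀ a₁ a₂ a a' z b₁ b₁' b₂ b₂' d d' →
             (u ⊕ (a₀ ⊕ a₀)) ⊕ (b₁ ⊕ (b₂ ⊕ (a ⊕ (b₁' ⊕ (z ⊕ (b₂' ⊕ (d ⊕ (a' ⊕ d')))))))) ⊜
             (((((b₁' ⊕ a₀) ⊕ (b₂' ⊕ a₀)) ⊕ (z ⊕ b₁)) ⊕ (a' ⊕ b₂)) ⊕ (d' ⊕ a)) ⊕ (u ⊕ d))
             refl y u a₀ a₁ a₂ a a' z b₁ b₁' b₂ b₂' d d' ⟩
      (((((b₁' ∙ a₀) ∙ (b₂' ∙ a₀)) ∙ (z ∙ b₁)) ∙ (a' ∙ b₂)) ∙ (d' ∙ a)) ∙ (u ∙ d)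
        ≈⟨ sym (∙-cong (∙-cong (∙-cong (∙-cong (∙-cong E₁ E₂) (sym E₃)) E₄) E₅) E₆) ⟩
      (((((b₁ ∙ a₁) ∙ (b₂ ∙ a₂)) ∙ (a ∙ b₁')) ∙ (z ∙ b₂')) ∙ (d ∙ a')) ∙ (y ∙ d')
        ≈⟨ solve 14 (λ y u a₀ a₁ a₂ a a' z b₁ b₁' b₂ b₂' d d' →
             (((((b₁ ⊕ a₁) ⊕ (b₂ ⊕ a₂)) ⊕ (a ⊕ b₁')) ⊕ (z ⊕ b₂')) ⊕ (d ⊕ a')) ⊕ (y ⊕ d') ⊜
             (y ⊕ (a₁ ⊕ a₂)) ⊕ (b₁ ⊕ (b₂ ⊕ (a ⊕ (b₁' ⊕ (z ⊕ (b₂' ⊕ (d ⊕ (a' ⊕ d')))))))))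
             refl y u a₀ a₁ a₂ a a' z b₁ b₁' b₂ b₂' d d' ⟩
      (y ∙ (a₁ ∙ a₂)) ∙ K ∎)
    where
    open import Relation.Binary.Reasoning.Setoid setoid
    K : X
    K = b₁ ∙ (b₂ ∙ (a ∙ (b₁' ∙ (z ∙ (b₂' ∙ (d ∙ (a' ∙ d')))))))

  module _ {A B T : List X} (A! : Unique A) (B! : Unique B) (T=A+B : IsSumset G A B T) where

    α β t : ℕ
    α = length A
    β = length B
    t = length T

    ∙-∈ : ∀ {a b} → a ∈ A → b ∈ B → a ∙ b ∈ T
    ∙-∈ {a} {b} a∈A b∈B = Equivalence.from (proj₂ T=A+B (a ∙ b)) (a , b , a∈A , b∈B , refl)

    B-translates-meet : t < β + β → ∀ {a a'} → a ∈ A → a' ∈ A →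
                        DoubleNegation (∃[ b ] ∃[ b' ] b ∈ B × b' ∈ B × b ∙ a ≈ b' ∙ a')
    B-translates-meet t<2β a∈A a'∈A = translates-meet B! B!
      (λ b∈B → ∈-resp-≈ setoid (comm _ _) (∙-∈ a∈A b∈B))
      (λ b∈B → ∈-resp-≈ setoid (comm _ _) (∙-∈ a'∈A b∈B)) t<2β

    Shifted : X → X → X → Set (c ⊔ ℓ)
    Shifted h h' z = ∃[ a ] a ∈ A × z ∙ h ≈ a ∙ h'

    Shifted-resp : ∀ {h h'} {z z'} → z ≈ z' → Shifted h h' z → Shifted h h' z'
    Shifted-resp z≈z' (a , a∈A , zh≈ah') = a , a∈A , trans (∙-congʳ (sym z≈z')) zh≈ah'

    record ShiftedSet (h h' : X) : Set (c ⊔ ℓ) where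
      field
        H : List X
        H! : Unique H
        H⊆A : All (_∈ A) H
        shifted : All (Shifted h h') H
        large : α + α ≤ length H + t

    ¬¬-shifted-set : ∀ {h h'} → h ∈ B → h' ∈ B → DoubleNegation (ShiftedSet h h')
    ¬¬-shifted-set {h} {h'} h∈B h'∈B k = ¬¬-partition (Shifted h h') A λ part →
      let open Partition part
          rejected⊆A : All (_∈ A) rejected
          rejected⊆A = All-resp-⊆ rejected⊑ A⊆A
          rejected-small : length rejected + α ≤ t
          rejected-small = ≮⇒≥ λ t<rejected+α →
            translates-meet (AllPairs-resp-⊑ rejected⊑ A!) A!
              (λ x∈rejected → ∙-∈ (All.lookupₛ setoid (∈-resp-≈ setoid) rejected⊆A x∈rejected) h∈B)
              (λ a∈A → ∙-∈ a∈A h'∈B) t<rejected+α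
              λ (x , a , x∈rejected , a∈A , xh≈ah') →
                All.lookupₛ setoid (λ x≈y ¬Px → ¬Px ∘ Shifted-resp (sym x≈y)) all-rejected x∈rejected
                  (a , a∈A , xh≈ah')
      in k (record
        { H = accepted ; H! = AllPairs-resp-⊑ accepted⊑ A! ; H⊆A = All-resp-⊆ accepted⊑ A⊆A
        ; shifted = all-accepted
        ; large = begin
            α + α                                   ≡⟨ ≡.cong (_+ α) (≡.sym length-partition) ⟩
            (length accepted + length rejected) + α ≡⟨ +-assoc (length accepted) _ α ⟩
            length accepted + (length rejected + α) ≤⟨ +-monoʳ-≤ (length accepted) rejected-small ⟩
            length accepted + t                     ∎ })
      where
      open ≤-Reasoning
      A⊆A : All (_∈ A) A
      A⊆A = All.tabulateₛ setoid id

    Represents : X → X → Set (c ⊔ ℓ)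
    Represents y f = ∃[ b ] b ∈ B × y ≈ f ∙ b

    Represents-resp : ∀ {y f f'} → f ≈ f' → Represents y f → Represents y f'
    Represents-resp f≈f' (b , b∈B , y≈fb) = b , b∈B , trans y≈fb (∙-congʳ f≈f')

    record PopularSum : Set (c ⊔ ℓ) where
      field
        y : X
        F : List X
        F! : Unique F
        F⊆A : All (_∈ A) F
        represents : All (Represents y) F
        popular : t < length F + α

    ¬¬-popular-sum : 0 < β → t < β + β → 2 * t < 3 * α → DoubleNegation PopularSum
    ¬¬-popular-sum 0<β t<2β 2t<3α no-popular-sum =
      αβ≰t*[t∸α] α β t 0<β t<2β 2t<3α (≤-trans (≤-reflexive (≡.sym (length-cartesianProduct A B)))
        (count-by-fibres fibres-bounded T (Uniqueₚ.cartesianProduct⁺ setoid setoid A! B!) A×B-members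
                         (All.map (λ (a∈A , b∈B) → ∙-∈ a∈A b∈B) A×B-members)))
      where
      open FibreCounting (setoid ×ₛ setoid) setoid (λ (a , b) → a ∈ A × b ∈ B) (λ (a , b) → a ∙ b) (t ∸ α)

      A×B-members : All (λ (a , b) → a ∈ A × b ∈ B) (cartesianProduct A B)
      A×B-members = All.tabulateₛ (setoid ×ₛ setoid) (Membershipₚ.∈-cartesianProduct⁻ setoid setoid A B)

      fibres-bounded : FibresBounded
      fibres-bounded {y} {F} F! F-members F≈y = m+n≤o⇒m≤o∸n (length F) (≮⇒≥ λ t<F+α →
        no-popular-sum (record
          { y = y ; F = map proj₁ F ; F! = fibre-heads-unique F! F≈y
          ; F⊆A = Allₚ.map⁺ (All.map proj₁ F-members)
          ; represents = Allₚ.map⁺ (All.zipWith (λ ((_ , b∈B) , ab≈y) → _ , b∈B , sym ab≈y) (F-members , F≈y))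
          ; popular = ≡.subst (λ n → t < n + α) (≡.sym (length-map proj₁ F)) t<F+α }))

    popular-translate : (P : PopularSum) → ∀ {b b'} → b ∈ B → b' ∈ B →
                        DoubleNegation (∃[ u ] u ∈ T × PopularSum.y P ∙ b ≈ u ∙ b')
    popular-translate P b∈B b'∈B k =
      translates-meet F! A! (λ f∈F → ∙-∈ (All.lookupₛ setoid (∈-resp-≈ setoid) F⊆A f∈F) b∈B)
        (λ a∈A → ∙-∈ a∈A b'∈B) popular
        λ (f , a , f∈F , a∈A , fb≈ab') →
          let c , c∈B , y≈fc = All.lookupₛ setoid Represents-resp represents f∈F
          in k (a ∙ c , ∙-∈ a∈A c∈B , popular-identity y≈fc fb≈ab')
      where open PopularSum P

    double-translate : t < β + β → 2 * t < 3 * α → (P : PopularSum) → ∀ {a₀ a₁ a₂} →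
                       a₀ ∈ A → a₁ ∈ A → a₂ ∈ A →
                       DoubleNegation (∃[ u ] u ∈ T × u ∙ (a₀ ∙ a₀) ≈ PopularSum.y P ∙ (a₁ ∙ a₂))
    double-translate t<2β 2t<3α P a₀∈A a₁∈A a₂∈A k =
      B-translates-meet t<2β a₁∈A a₀∈A λ (b₁ , b₁' , b₁∈B , b₁'∈B , E₁) →
      B-translates-meet t<2β a₂∈A a₀∈A λ (b₂ , b₂' , b₂∈B , b₂'∈B , E₂) →
      ¬¬-shifted-set b₁∈B b₁'∈B λ S₁ →
      ¬¬-shifted-set b₂'∈B b₂∈B λ S₂ →
      let open ShiftedSet S₁ renaming (H to H₁; H! to H₁!; H⊆A to H₁⊆A; shifted to shifted₁; large to large₁)
          open ShiftedSet S₂ renaming (H to H₂; H! to H₂!; H⊆A to H₂⊆A; shifted to shifted₂; large to large₂)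
      in pigeonhole H₁! H₂! H₁⊆A H₂⊆A (shifted-sets-overlap large₁ large₂) λ (z , z∈H₁ , z∈H₂) →
      let a  , a∈A  , E₃ = All.lookupₛ setoid Shifted-resp shifted₁ z∈H₁
          a' , a'∈A , E₄ = All.lookupₛ setoid Shifted-resp shifted₂ z∈H₂
      in B-translates-meet t<2β a'∈A a∈A λ (d , d' , d∈B , d'∈B , E₅) →
      popular-translate P d'∈B d∈B λ (u , u∈T , E₆) →
      k (u , u∈T , double-identity E₁ E₂ E₃ E₄ E₅ E₆)
      where
      shifted-sets-overlap : ∀ {h₁ h₂} → α + α ≤ h₁ + t → α + α ≤ h₂ + t → α < h₁ + h₂
      shifted-sets-overlap {h₁} {h₂} 2α≤h₁+t 2α≤h₂+t = +-cancelʳ-< (3 * α) α (h₁ + h₂) (begin-strict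
        α + 3 * α             ≡⟨ four α ⟩
        (α + α) + (α + α)     ≤⟨ +-mono-≤ 2α≤h₁+t 2α≤h₂+t ⟩
        (h₁ + t) + (h₂ + t)   ≡⟨ regroup h₁ h₂ t ⟩
        (h₁ + h₂) + 2 * t     <⟨ +-monoʳ-< (h₁ + h₂) 2t<3α ⟩
        (h₁ + h₂) + 3 * α     ∎)
        where
        open ≤-Reasoning
        four : ∀ α → α + 3 * α ≡ (α + α) + (α + α)
        four = solve-∀
        regroup : ∀ h₁ h₂ t → (h₁ + t) + (h₂ + t) ≡ (h₁ + h₂) + 2 * t
        regroup = solve-∀

    doubling≤sumset : ∀ {S₂} → IsSumset G A A S₂ → A ≢ [] → B ≢ [] → t < β + β → 2 * t < 3 * α →
                      length S₂ ≤ t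
    doubling≤sumset {S₂} S₂=A+A A≢[] B≢[] t<2β 2t<3α = decidable-stable (_ ≤? _) λ S₂≰t →
      ¬¬-popular-sum (Membershipₚ.∈-length setoid (proj₂ (nonempty-member B≢[]))) t<2β 2t<3α λ P →
      All.mapM ℓ ¬¬-Monad (translate-into-T P) (All.tabulateₛ setoid id) λ translate[S₂]⊆T →
      S₂≰t (≤-trans (≤-reflexive (≡.sym (length-map (translate (PopularSum.y P)) S₂)))
                    (length-mono-⊆ (Uniqueₚ.map⁺ setoid setoid translate-injective (proj₁ S₂=A+A))
                                   (Allₚ.map⁺ translate[S₂]⊆T)))
      where
      a₀ : X
      a₀ = proj₁ (nonempty-member A≢[])
      a₀∈A : a₀ ∈ A
      a₀∈A = proj₂ (nonempty-member A≢[])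

      translate : X → X → X
      translate y x = (y ∙ x) ∙ (a₀ ∙ a₀) ⁻¹

      translate-injective : ∀ {y x x'} → translate y x ≈ translate y x' → x ≈ x'
      translate-injective {y} = ∙-cancelˡ y _ _ ∘ ∙-cancelʳ ((a₀ ∙ a₀) ⁻¹) _ _

      translate-into-T : (P : PopularSum) → ∀ {x} → x ∈ S₂ → DoubleNegation (translate (PopularSum.y P) x ∈ T)
      translate-into-T P {x} x∈S₂ k =
        let a₁ , a₂ , a₁∈A , a₂∈A , x≈a₁a₂ = Equivalence.to (proj₂ S₂=A+A x) x∈S₂
        in double-translate t<2β 2t<3α P a₀∈A a₁∈A a₂∈A λ (u , u∈T , E) →
           k (∈-resp-≈ setoid (trans (x≈z//y u (a₀ ∙ a₀) _ E) (∙-congʳ (∙-congˡ (sym x≈a₁a₂)))) u∈T)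

corollary3 : ∀ {c ℓ} (G : AbelianGroup c ℓ) (A B S2 S : List (AbelianGroup.Carrier G)) →
             IsFinSubset G A → IsFinSubset G B → A ≢ [] → B ≢ [] →
             IsSumset G A A S2 → IsSumset G A B S →
             3 * length A ≤ 2 * length S2 →
             (4 * length B) ⊓ (3 * length A) ≤ 2 * length S
corollary3 G A B S2 S A! B! A≢[] B≢[] S2=A+A S=A+B 3α≤2|2A| = ≮⇒≥ λ 2t<min →
  let 2t<4β = m<n⊓o⇒m<n (4 * length B) (3 * length A) 2t<min
      2t<3α = m<n⊓o⇒m<o (4 * length B) (3 * length A) 2t<min
      |2A|≤t = doubling≤sumset G A! B! S=A+B S2=A+A A≢[] B≢[] (2*m<4*n⇒m<n+n (length S) (length B) 2t<4β) 2t<3α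
  in <⇒≱ 2t<3α (≤-trans 3α≤2|2A| (*-monoʳ-≤ 2 |2A|≤t))
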